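{- Let $X$ be an orientable map with transition matrix $U$ and let $\tau$ be a positive integer. If $\tau$ is even, then $U^\tau=I$ if and only if $X$ is periodic at time $\tau$. If $\tau$ is odd, then $U^\tau=I$ if and only if $X$ is periodic at time $\tau$ and $|V|=|F|$. Furthermore, if $X$ is periodic at time $\tau$, then $U^{2\tau}=I$.
   Context: An orientable map $X$ is a 2-cell embedding of a finite connected multigraph (loops and parallel edges allowed) in a closed orientable surface, with vertex set $V$, edge set $E$ and face set $F$. Each edge gives rise to two arcs on opposite sides of it, pointing in opposite directions; each arc lies in a face and is oriented along the clockwise facial walk of that face. Let $\mathcal A$ be the set of arcs, $v(a)$ the tail vertex and $f(a)$ the face of arc $a$. Let $N\in\{0,1\}^{\mathcal A\times V}$ with $N(a,v)=1$ iff $v=v(a)$, $M\in\{0,1\}^{\mathcal A\times F}$ with $M(a,f)=1$ iff $f=f(a)$, $D=N^TN$, $\Delta=M^TM$, $\hat N=ND^{ -1/2}$, $\hat M=M\Delta^{ -1/2}$, $Q=\hat N\hat N^T$, $P=\hat M\hat M^T$, and $U=(2P-I)(2Q-I)$. The map $X$ is periodic at time $\tau$ if $U^\tau\hat N=\hat N$. -}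

module Defs where

open import Data.Nat as ℕ using (ℕ; zero; suc)
open import Data.Fin using (Fin; zero; suc; _≟_)
open import Data.Rational using (ℚ; 0ℚ; 1ℚ; 1/_; _+_; _*_; _-_; ≢-nonZero)
open import Data.Rational.Properties using () renaming (_≟_ to _≟ℚ_)
open import Data.Product using (Σ; ∃; _×_)
open import Relation.Binary.PropositionalEquality using (_≡_; _≢_)
open import Relation.Nullary using (yes; no)
open import Function.Definitions using (Injective)
open import Function.Bundles using (_⇔_)

sumFin : (n : ℕ) → (Fin n → ℚ) → ℚ
sumFin zero    f = 0ℚ
sumFin (suc n) f = f zero + sumFin n (λ i → f (suc i))

Mat : ℕ → ℕ → Set
Mat m n = Fin m → Fin n → ℚ

_⊗_ : {m n k : ℕ} → Mat m n → Mat n k → Mat m k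
_⊗_ {n = n} A B i j = sumFin n (λ l → A i l * B l j)

transpose : {m n : ℕ} → Mat m n → Mat n m
transpose A i j = A j i

δ : {n : ℕ} → Fin n → Fin n → ℚ
δ i j with i ≟ j
... | yes _ = 1ℚ
... | no  _ = 0ℚ

idMat : (n : ℕ) → Mat n n
idMat n = δ

twoMinusI : {n : ℕ} → Mat n n → Mat n n
twoMinusI A i j = (A i j + A i j) - δ i j

matPow : {n : ℕ} → Mat n n → ℕ → Mat n n
matPow {n} A zero    = idMat n
matPow     A (suc k) = A ⊗ matPow A k

_≈ᴹ_ : {m n : ℕ} → Mat m n → Mat m n → Set
A ≈ᴹ B = ∀ i j → A i j ≡ B i j

-- inverse of a rational, with 0 ↦ 0 (only applied to nonzero degrees)
inv0 : ℚ → ℚ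
inv0 p with p ≟ℚ 0ℚ
... | yes _  = 0ℚ
... | no p≢0 = 1/_ p {{≢-nonZero p≢0}}

iter : {A : Set} → (A → A) → ℕ → A → A
iter f zero    x = x
iter f (suc k) x = f (iter f k x)

-- Orientable maps as combinatorial maps (rotation systems).
-- Arcs (= darts) are Fin nA.  σ is the rotation of arcs around their
-- tail vertex, θ is the fixed-point-free involution sending an arc to the
-- arc on the other side of the same edge (pointing the other way);
-- φ = σ ∘ θ is the face permutation (the next arc along the facial walk).
-- Vertices are Fin nV, faces Fin nF, with tail map `vert` and face map
-- `face` whose fibres are exactly the σ-orbits, resp. φ-orbits.

data Reach {n : ℕ} (σ θ : Fin n → Fin n) (a : Fin n) : Fin n → Set where
  here  : Reach σ θ a a
  stepσ : ∀ {b} → Reach σ θ a b → Reach σ θ a (σ b)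
  stepθ : ∀ {b} → Reach σ θ a b → Reach σ θ a (θ b)

record OrientableMap : Set where
  field
    nA nV nF : ℕ
    σ θ      : Fin nA → Fin nA
    σ-inj    : Injective _≡_ _≡_ σ
    θ-invol  : ∀ a → θ (θ a) ≡ a
    θ-nofix  : ∀ a → θ a ≢ a
    connected : ∀ a b → Reach σ θ a b
    vert     : Fin nA → Fin nV
    face     : Fin nA → Fin nF
    vert-surj : ∀ v → ∃ λ a → vert a ≡ v
    face-surj : ∀ f → ∃ λ a → face a ≡ f
    vert-orbit : ∀ a b → (vert a ≡ vert b) ⇔ (∃ λ k → iter σ k a ≡ b)
    face-orbit : ∀ a b → (face a ≡ face b) ⇔ (∃ λ k → iter (λ x → σ (θ x)) k a ≡ b)

module _ (X : OrientableMap) where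
  open OrientableMap X

  Nmat : Mat nA nV
  Nmat a v = δ (vert a) v

  Mmat : Mat nA nF
  Mmat a f = δ (face a) f

  Dmat : Mat nV nV
  Dmat = transpose Nmat ⊗ Nmat

  Δmat : Mat nF nF
  Δmat = transpose Mmat ⊗ Mmat

  -- D⁻¹ and Δ⁻¹ (D, Δ are diagonal with positive diagonal entries)
  Dinv : Mat nV nV
  Dinv v w = δ v w * inv0 (Dmat v v)

  Δinv : Mat nF nF
  Δinv f g = δ f g * inv0 (Δmat f f)

  -- Q = N̂ N̂ᵀ = N D^{-1/2} D^{-1/2} Nᵀ = N D⁻¹ Nᵀ ; likewise P = M Δ⁻¹ Mᵀ
  Qmat : Mat nA nA
  Qmat = (Nmat ⊗ Dinv) ⊗ transpose Nmat

  Pmat : Mat nA nA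
  Pmat = (Mmat ⊗ Δinv) ⊗ transpose Mmat

  Umat : Mat nA nA
  Umat = twoMinusI Pmat ⊗ twoMinusI Qmat

  -- periodic at time τ :  U^τ N̂ = N̂.  Since N̂ = N D^{-1/2} with D^{-1/2}
  -- an invertible diagonal matrix, this is stated as U^τ N = N.
  Periodic : ℕ → Set
  Periodic τ = (matPow Umat τ ⊗ Nmat) ≈ᴹ Nmat

{-# OPTIONS --safe #-}
module Submission where

-- Write R = 2Q − I and S = 2P − I. As Q and P are symmetric idempotents, R and S are
-- symmetric involutions, so U = SR is orthogonal with inverse U⁻¹ = RS = RUR = SUS.
-- If U^τ N = N then W = U^τ fixes Q on the left and, transposing the same identity for
-- U⁻¹^τ = R W R, on the right; hence W commutes with R, so W = RWR = U⁻¹^τ and W² = I.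
-- For E = I − W this gives EQ = 0, hence ER = −E, and EW = −E; W also commutes with S,
-- so EU² = E. For even τ, E = EW = −E forces E = 0. For odd τ = 2m + 1, cyclicity of the
-- trace gives tr(U^τ R) = tr(U^m S U⁻¹^m) = tr S, while tr R = 2|V| − |A| and
-- tr S = 2|F| − |A|: so U^τ = I forces |V| = |F|, and conversely |V| = |F| gives
-- tr E = tr(WR) − tr R = 0, whence tr(E Eᵀ) = tr(E²) = 2 tr E = 0 and E = 0.

open import Defs
open import Data.Nat.Base using (ℕ; zero; suc)
open import Data.Fin.Base using (Fin; zero; suc)
open import Data.Product.Base using (∃)
open import Relation.Binary.PropositionalEquality using (_≡_)
open import Algebra.Bundles using (Ring)

module Rationals where
  open import Data.Sum.Base using (inj₁; inj₂)
  open import Data.Empty using (⊥-elim)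
  open import Relation.Nullary using (yes; no)
  open import Relation.Binary.PropositionalEquality using (_≡_; _≢_; refl; sym; trans; cong)
  open import Data.Rational.Base using (ℚ; 0ℚ; 1ℚ; _+_; _*_; _≤_; -_; +-0-rawMonoid)
  open import Data.Rational.Base using (nonNegative; nonPositive; positive; negative; ≢-nonZero)
  open import Data.Rational.Properties
  open import Algebra.Properties.Ring +-*-ring using (+-cancelˡ)
  open import Algebra.Definitions.RawMonoid +-0-rawMonoid using (_×_)
  open import Relation.Binary.Definitions using (tri<; tri≈; tri>)

  fromℕ : ℕ → ℚ
  fromℕ n = n × 1ℚ

  fromℕ-nonneg : ∀ n → 0ℚ ≤ fromℕ n
  fromℕ-nonneg zero    = ≤-refl
  fromℕ-nonneg (suc n) = +-mono-≤ (nonNegative⁻¹ 1ℚ) (fromℕ-nonneg n)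

  fromℕ-suc≢0 : ∀ n → fromℕ (suc n) ≢ 0ℚ
  fromℕ-suc≢0 n eq = <-irrefl (sym eq) (+-mono-<-≤ (positive⁻¹ 1ℚ) (fromℕ-nonneg n))

  fromℕ-injective : ∀ m n → fromℕ m ≡ fromℕ n → m ≡ n
  fromℕ-injective zero    zero    _  = refl
  fromℕ-injective zero    (suc n) eq = ⊥-elim (fromℕ-suc≢0 n (sym eq))
  fromℕ-injective (suc m) zero    eq = ⊥-elim (fromℕ-suc≢0 m eq)
  fromℕ-injective (suc m) (suc n) eq = cong suc (fromℕ-injective m n (+-cancelˡ 1ℚ _ _ eq))

  inv0-inverseʳ : ∀ p → p ≢ 0ℚ → p * inv0 p ≡ 1ℚ
  inv0-inverseʳ p p≢0 with p ≟ 0ℚ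
  ... | yes p≡0 = ⊥-elim (p≢0 p≡0)
  ... | no p≢0′ = *-inverseʳ p {{≢-nonZero p≢0′}}

  x+x≡y+y⇒x≡y : ∀ x y → x + x ≡ y + y → x ≡ y
  x+x≡y+y⇒x≡y x y eq with <-cmp x y
  ... | tri< x<y _ _ = ⊥-elim (<-irrefl eq (+-mono-< x<y x<y))
  ... | tri≈ _ x≡y _ = x≡y
  ... | tri> _ _ x>y = ⊥-elim (<-irrefl (sym eq) (+-mono-< x>y x>y))

  x≡-x⇒x≡0 : ∀ x → x ≡ - x → x ≡ 0ℚ
  x≡-x⇒x≡0 x x≡-x = x+x≡y+y⇒x≡y x 0ℚ (trans (cong (x +_) x≡-x) (+-inverseʳ x))

  x*x-nonneg : ∀ x → 0ℚ ≤ x * x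
  x*x-nonneg x with ≤-total 0ℚ x
  ... | inj₁ 0≤x = let instance _ = nonNegative 0≤x in nonNegative⁻¹ (x * x) {{nonNeg*nonNeg⇒nonNeg x x}}
  ... | inj₂ x≤0 = let instance _ = nonPositive x≤0 in nonNegative⁻¹ (x * x) {{nonPos*nonPos⇒nonPos x x}}

  x*x≡0⇒x≡0 : ∀ x → x * x ≡ 0ℚ → x ≡ 0ℚ
  x*x≡0⇒x≡0 x xx≡0 with <-cmp x 0ℚ
  ... | tri≈ _ x≡0 _ = x≡0
  ... | tri< x<0 _ _ = let instance _ = negative x<0 in
    ⊥-elim (<-irrefl (sym xx≡0) (positive⁻¹ (x * x) {{neg*neg⇒pos x x}}))
  ... | tri> _ _ x>0 = let instance _ = positive x>0 in
    ⊥-elim (<-irrefl (sym xx≡0) (positive⁻¹ (x * x) {{pos*pos⇒pos x x}}))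

module FiniteSums where
  open import Relation.Binary.PropositionalEquality
    using (_≡_; refl; sym; trans; cong; cong₂; subst; module ≡-Reasoning)
  open import Data.Rational.Base using (ℚ; 0ℚ; 1ℚ; _+_; _*_; _≤_)
  open import Data.Rational.Properties
  open import Algebra.Properties.Semiring.Sum (Ring.semiring +-*-ring)
    using (sum; sum-cong-≗; ∑-distrib-+; ∑-comm; *-distribˡ-sum; sum-replicate; sum-replicate-zero)
  open Rationals using (fromℕ)

  sumFin≡sum : ∀ n (f : Fin n → ℚ) → sumFin n f ≡ sum f
  sumFin≡sum zero    f = refl
  sumFin≡sum (suc n) f = cong (f zero +_) (sumFin≡sum n (λ i → f (suc i)))

  sumFin-cong : ∀ n {f g : Fin n → ℚ} → (∀ i → f i ≡ g i) → sumFin n f ≡ sumFin n g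
  sumFin-cong zero    f≗g = refl
  sumFin-cong (suc n) f≗g = cong₂ _+_ (f≗g zero) (sumFin-cong n (λ i → f≗g (suc i)))

  sumFin-+ : ∀ n (f g : Fin n → ℚ) → sumFin n (λ i → f i + g i) ≡ sumFin n f + sumFin n g
  sumFin-+ n f g
    rewrite sumFin≡sum n (λ i → f i + g i) | sumFin≡sum n f | sumFin≡sum n g = ∑-distrib-+ f g

  sumFin-*ˡ : ∀ n x (f : Fin n → ℚ) → sumFin n (λ i → x * f i) ≡ x * sumFin n f
  sumFin-*ˡ n x f
    rewrite sumFin≡sum n (λ i → x * f i) | sumFin≡sum n f = sym (*-distribˡ-sum x f)

  sumFin-comm : ∀ m n (f : Fin m → Fin n → ℚ) →
    sumFin m (λ i → sumFin n (f i)) ≡ sumFin n (λ j → sumFin m (λ i → f i j))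
  sumFin-comm m n f = begin
    sumFin m (λ i → sumFin n (f i))            ≡⟨ sumFin≡sum m _ ⟩
    sum (λ i → sumFin n (f i))                 ≡⟨ sum-cong-≗ (λ i → sumFin≡sum n (f i)) ⟩
    sum (λ i → sum (f i))                      ≡⟨ ∑-comm f ⟩
    sum (λ j → sum (λ i → f i j))              ≡⟨ sum-cong-≗ (λ j → sumFin≡sum m (λ i → f i j)) ⟨
    sum (λ j → sumFin m (λ i → f i j))         ≡⟨ sumFin≡sum n _ ⟨
    sumFin n (λ j → sumFin m (λ i → f i j))    ∎
    where open ≡-Reasoning

  sumFin-0 : ∀ n → sumFin n (λ _ → 0ℚ) ≡ 0ℚ
  sumFin-0 n = trans (sumFin≡sum n _) (sum-replicate-zero n)

  sumFin-0* : ∀ n (f : Fin n → ℚ) → sumFin n (λ i → 0ℚ * f i) ≡ 0ℚ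
  sumFin-0* n f = trans (sumFin-*ˡ n 0ℚ f) (*-zeroˡ (sumFin n f))

  sumFin-const-1 : ∀ n → sumFin n (λ _ → 1ℚ) ≡ fromℕ n
  sumFin-const-1 n = trans (sumFin≡sum n _) (sum-replicate n)

  sumFin-nonneg : ∀ n (f : Fin n → ℚ) → (∀ i → 0ℚ ≤ f i) → 0ℚ ≤ sumFin n f
  sumFin-nonneg zero    f f≥0 = ≤-refl
  sumFin-nonneg (suc n) f f≥0 =
    +-mono-≤ (f≥0 zero) (sumFin-nonneg n (λ i → f (suc i)) (λ i → f≥0 (suc i)))

  term≤sumFin : ∀ n (f : Fin n → ℚ) → (∀ i → 0ℚ ≤ f i) → ∀ k → f k ≤ sumFin n f
  term≤sumFin (suc n) f f≥0 zero = begin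
    f zero                                  ≡⟨ +-identityʳ (f zero) ⟨
    f zero + 0ℚ                             ≤⟨ +-monoʳ-≤ (f zero) (sumFin-nonneg n _ (λ i → f≥0 (suc i))) ⟩
    f zero + sumFin n (λ i → f (suc i))     ∎
    where open ≤-Reasoning
  term≤sumFin (suc n) f f≥0 (suc k) = begin
    f (suc k)                               ≤⟨ term≤sumFin n _ (λ i → f≥0 (suc i)) k ⟩
    sumFin n (λ i → f (suc i))              ≡⟨ +-identityˡ _ ⟨
    0ℚ + sumFin n (λ i → f (suc i))         ≤⟨ +-monoˡ-≤ _ (f≥0 zero) ⟩
    f zero + sumFin n (λ i → f (suc i))     ∎
    where open ≤-Reasoning

  sumFin≡0⇒≡0 : ∀ n (f : Fin n → ℚ) → (∀ i → 0ℚ ≤ f i) → sumFin n f ≡ 0ℚ → ∀ k → f k ≡ 0ℚ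
  sumFin≡0⇒≡0 n f f≥0 ∑f≡0 k = ≤-antisym (subst (f k ≤_) ∑f≡0 (term≤sumFin n f f≥0 k)) (f≥0 k)

module Kronecker where
  open import Data.Empty using (⊥-elim)
  open import Relation.Nullary using (yes; no)
  import Data.Fin.Properties as Fin
  open import Relation.Binary.PropositionalEquality
    using (_≡_; _≢_; refl; sym; trans; cong; cong₂; module ≡-Reasoning)
  open import Data.Rational.Base using (ℚ; 0ℚ; 1ℚ; _+_; _*_; _≤_)
  open import Data.Rational.Properties
  open FiniteSums

  δ-diag : ∀ {n} (i : Fin n) → δ i i ≡ 1ℚ
  δ-diag i with i Fin.≟ i
  ... | yes _   = refl
  ... | no i≢i = ⊥-elim (i≢i refl)

  δ-≢ : ∀ {n} {i j : Fin n} → i ≢ j → δ i j ≡ 0ℚ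
  δ-≢ {i = i} {j} i≢j with i Fin.≟ j
  ... | yes i≡j = ⊥-elim (i≢j i≡j)
  ... | no _    = refl

  δ-sym : ∀ {n} (i j : Fin n) → δ i j ≡ δ j i
  δ-sym i j with i Fin.≟ j
  ... | yes refl = sym (δ-diag i)
  ... | no i≢j  = sym (δ-≢ (λ j≡i → i≢j (sym j≡i)))

  δ-suc : ∀ {n} (i j : Fin n) → δ (suc i) (suc j) ≡ δ i j
  δ-suc i j with i Fin.≟ j
  ... | yes _ = refl
  ... | no _  = refl

  δ-nonneg : ∀ {n} (i j : Fin n) → 0ℚ ≤ δ i j
  δ-nonneg i j with i Fin.≟ j
  ... | yes _ = nonNegative⁻¹ 1ℚ
  ... | no _  = ≤-refl

  δ-*-transport : ∀ {n} (i j : Fin n) (f : Fin n → ℚ) → δ i j * f i ≡ δ i j * f j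
  δ-*-transport i j f with i Fin.≟ j
  ... | yes refl = refl
  ... | no _     = trans (*-zeroˡ (f i)) (sym (*-zeroˡ (f j)))

  sumFin-δˡ : ∀ n (i : Fin n) (f : Fin n → ℚ) → sumFin n (λ l → δ i l * f l) ≡ f i
  sumFin-δˡ (suc n) zero f = begin
    1ℚ * f zero + sumFin n (λ l → 0ℚ * f (suc l))
      ≡⟨ cong₂ _+_ (*-identityˡ (f zero)) (sumFin-0* n (λ l → f (suc l))) ⟩
    f zero + 0ℚ
      ≡⟨ +-identityʳ (f zero) ⟩
    f zero ∎
    where open ≡-Reasoning
  sumFin-δˡ (suc n) (suc i) f = begin
    0ℚ * f zero + sumFin n (λ l → δ (suc i) (suc l) * f (suc l))
      ≡⟨ cong₂ _+_ (*-zeroˡ (f zero)) (sumFin-cong n (λ l → cong (_* f (suc l)) (δ-suc i l))) ⟩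
    0ℚ + sumFin n (λ l → δ i l * f (suc l))
      ≡⟨ trans (+-identityˡ _) (sumFin-δˡ n i (λ l → f (suc l))) ⟩
    f (suc i) ∎
    where open ≡-Reasoning

  sumFin-δʳ : ∀ n (j : Fin n) (f : Fin n → ℚ) → sumFin n (λ l → f l * δ l j) ≡ f j
  sumFin-δʳ n j f =
    trans (sumFin-cong n (λ l → trans (*-comm (f l) (δ l j)) (cong (_* f l) (δ-sym l j))))
          (sumFin-δˡ n j f)

module Reflections {c ℓ} (R : Ring c ℓ) where
  open Ring R
  open import Algebra.Properties.Ring R
  open import Algebra.Properties.Semiring.Exp semiring using (_^_; ^-congʳ; ^-homo-*; ^-assocʳ)
  import Data.Nat.Base as ℕ
  import Data.Nat.Properties as ℕ
  open import Relation.Binary.PropositionalEquality using (_≡_)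
  open import Relation.Binary.Reasoning.Setoid setoid
  open import Tactic.MonoidSolver using (solve)

  reflection : Carrier → Carrier
  reflection x = (x + x) - 1#

  x+x-x≈x : ∀ x → (x + x) - x ≈ x
  x+x-x≈x x = xyx⁻¹≈y x x

  x-[x-y]≈y : ∀ x y → x - (x - y) ≈ y
  x-[x-y]≈y x y = begin
    x - (x - y)    ≈⟨ +-congˡ (⁻¹-anti-homo‿- x y) ⟩
    x + (y - x)    ≈⟨ +-congˡ (+-comm y (- x)) ⟩
    x + (- x + y)  ≈⟨ +-assoc x (- x) y ⟨
    (x - x) + y    ≈⟨ +-congʳ (-‿inverseʳ x) ⟩
    0# + y         ≈⟨ +-identityˡ y ⟩
    y              ∎

  *-reflection : ∀ x q → x * reflection q ≈ (x * q + x * q) - x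
  *-reflection x q = begin
    x * ((q + q) - 1#)        ≈⟨ x[y-z]≈xy-xz x (q + q) 1# ⟩
    x * (q + q) - x * 1#      ≈⟨ +-cong (distribˡ x q q) (-‿cong (*-identityʳ x)) ⟩
    (x * q + x * q) - x       ∎

  reflection-* : ∀ q x → reflection q * x ≈ (q * x + q * x) - x
  reflection-* q x = begin
    ((q + q) - 1#) * x        ≈⟨ [y-z]x≈yx-zx x (q + q) 1# ⟩
    (q + q) * x - 1# * x      ≈⟨ +-cong (distribʳ x q q) (-‿cong (*-identityˡ x)) ⟩
    (q * x + q * x) - x       ∎

  module _ {q : Carrier} (q-idem : q * q ≈ q) where

    reflection-fixes : reflection q * q ≈ q
    reflection-fixes = trans (reflection-* q q) (trans (+-congʳ (+-cong q-idem q-idem)) (x+x-x≈x q))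

    reflection-involutive : reflection q * reflection q ≈ 1#
    reflection-involutive = begin
      reflection q * reflection q
        ≈⟨ *-reflection (reflection q) q ⟩
      (reflection q * q + reflection q * q) - reflection q
        ≈⟨ +-congʳ (+-cong reflection-fixes reflection-fixes) ⟩
      (q + q) - ((q + q) - 1#)
        ≈⟨ x-[x-y]≈y (q + q) 1# ⟩
      1# ∎

  reflection-comm : ∀ {q w} → w * q ≈ q → q * w ≈ q → w * reflection q ≈ reflection q * w
  reflection-comm {q} {w} wq≈q qw≈q = begin
    w * reflection q        ≈⟨ *-reflection w q ⟩
    (w * q + w * q) - w     ≈⟨ +-congʳ (+-cong wq≈q wq≈q) ⟩
    (q + q) - w             ≈⟨ +-congʳ (+-cong qw≈q qw≈q) ⟨
    (q * w + q * w) - w     ≈⟨ reflection-* q w ⟨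
    reflection q * w        ∎

  *-reflection-negates : ∀ {q e} → e * q ≈ 0# → e * reflection q ≈ - e
  *-reflection-negates {q} {e} eq≈0 = begin
    e * reflection q        ≈⟨ *-reflection e q ⟩
    (e * q + e * q) - e     ≈⟨ +-congʳ (+-cong eq≈0 eq≈0) ⟩
    (0# + 0#) - e           ≈⟨ +-congʳ (+-identityˡ 0#) ⟩
    0# - e                  ≈⟨ +-identityˡ (- e) ⟩
    - e                     ∎

  ^-comm : ∀ x k → x ^ k * x ≈ x * x ^ k
  ^-comm x zero    = trans (*-identityˡ x) (sym (*-identityʳ x))
  ^-comm x (suc k) = trans (*-assoc x (x ^ k) x) (*-congˡ (^-comm x k))

  ^-inverse : ∀ {x y} → x * y ≈ 1# → ∀ k → x ^ k * y ^ k ≈ 1#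
  ^-inverse         xy≈1 zero    = *-identityˡ 1#
  ^-inverse {x} {y} xy≈1 (suc k) = begin
    (x * x ^ k) * (y * y ^ k)   ≈⟨ *-congˡ (^-comm y k) ⟨
    (x * x ^ k) * (y ^ k * y)   ≈⟨ solve *-monoid ⟩
    x * ((x ^ k * y ^ k) * y)   ≈⟨ *-congˡ (*-congʳ (^-inverse xy≈1 k)) ⟩
    x * (1# * y)                ≈⟨ *-congˡ (*-identityˡ y) ⟩
    x * y                       ≈⟨ xy≈1 ⟩
    1#                          ∎

  ^-conj : ∀ {a x y} → a * a ≈ 1# → a * x * a ≈ y → ∀ k → a * x ^ k * a ≈ y ^ k
  ^-conj {a} aa≈1 axa≈y zero    = trans (*-congʳ (*-identityʳ a)) aa≈1
  ^-conj {a} {x} {y} aa≈1 axa≈y (suc k) = begin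
    a * (x * x ^ k) * a              ≈⟨ solve *-monoid ⟩
    a * x * (1# * x ^ k) * a         ≈⟨ *-congʳ (*-congˡ (*-congʳ aa≈1)) ⟨
    a * x * (a * a * x ^ k) * a      ≈⟨ solve *-monoid ⟩
    (a * x * a) * (a * x ^ k * a)  ≈⟨ *-cong axa≈y (^-conj aa≈1 axa≈y k) ⟩
    y * y ^ k                      ∎

  *-^-fixed : ∀ {x y} → x * y ≈ x → ∀ k → x * y ^ k ≈ x
  *-^-fixed     xy≈x zero    = *-identityʳ _
  *-^-fixed {x} {y} xy≈x (suc k) = begin
    x * (y * y ^ k)  ≈⟨ *-assoc x y (y ^ k) ⟨
    (x * y) * y ^ k  ≈⟨ *-congʳ xy≈x ⟩
    x * y ^ k        ≈⟨ *-^-fixed xy≈x k ⟩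
    x                ∎

  module Walk
    (t : Carrier → Carrier)
    (t-cong : ∀ {x y} → x ≈ y → t x ≈ t y)
    (t-+ : ∀ x y → t (x + y) ≈ t x + t y)
    (t-‿ : ∀ x → t (- x) ≈ - t x)
    (t-* : ∀ x y → t (x * y) ≈ t y * t x)
    (t-1 : t 1# ≈ 1#)
    {q p : Carrier} (q-idem : q * q ≈ q) (p-idem : p * p ≈ p) (t-q : t q ≈ q) (t-p : t p ≈ p)
    where

    r s U U⁻¹ : Carrier
    r   = reflection q
    s   = reflection p
    U   = s * r
    U⁻¹ = r * s

    r*r≈1 : r * r ≈ 1#
    r*r≈1 = reflection-involutive q-idem

    s*s≈1 : s * s ≈ 1#
    s*s≈1 = reflection-involutive p-idem

    U*U⁻¹≈1 : U * U⁻¹ ≈ 1#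
    U*U⁻¹≈1 = begin
      (s * r) * (r * s)  ≈⟨ solve *-monoid ⟩
      s * (r * r) * s    ≈⟨ *-congʳ (*-congˡ r*r≈1) ⟩
      s * 1# * s         ≈⟨ *-congʳ (*-identityʳ s) ⟩
      s * s              ≈⟨ s*s≈1 ⟩
      1#                 ∎

    U⁻¹*U≈1 : U⁻¹ * U ≈ 1#
    U⁻¹*U≈1 = begin
      (r * s) * (s * r)  ≈⟨ solve *-monoid ⟩
      r * (s * s) * r    ≈⟨ *-congʳ (*-congˡ s*s≈1) ⟩
      r * 1# * r         ≈⟨ *-congʳ (*-identityʳ r) ⟩
      r * r              ≈⟨ r*r≈1 ⟩
      1#                 ∎

    r*U*r≈U⁻¹ : r * U * r ≈ U⁻¹
    r*U*r≈U⁻¹ = begin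
      r * (s * r) * r    ≈⟨ solve *-monoid ⟩
      r * s * (r * r)    ≈⟨ *-congˡ r*r≈1 ⟩
      r * s * 1#         ≈⟨ *-identityʳ U⁻¹ ⟩
      r * s              ∎

    s*U*s≈U⁻¹ : s * U * s ≈ U⁻¹
    s*U*s≈U⁻¹ = begin
      s * (s * r) * s    ≈⟨ solve *-monoid ⟩
      (s * s) * (r * s)  ≈⟨ *-congʳ s*s≈1 ⟩
      1# * (r * s)       ≈⟨ *-identityˡ U⁻¹ ⟩
      r * s              ∎

    t-reflection : ∀ {x} → t x ≈ x → t (reflection x) ≈ reflection x
    t-reflection {x} tx≈x = begin
      t ((x + x) - 1#)       ≈⟨ t-+ (x + x) (- 1#) ⟩
      t (x + x) + t (- 1#)   ≈⟨ +-cong (t-+ x x) (t-‿ 1#) ⟩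
      (t x + t x) - t 1#     ≈⟨ +-cong (+-cong tx≈x tx≈x) (-‿cong t-1) ⟩
      (x + x) - 1#           ∎

    t-U : t U ≈ U⁻¹
    t-U = trans (t-* s r) (*-cong (t-reflection t-q) (t-reflection t-p))

    t-U⁻¹ : t U⁻¹ ≈ U
    t-U⁻¹ = trans (t-* r s) (*-cong (t-reflection t-p) (t-reflection t-q))

    t-^ : ∀ {x y} → t x ≈ y → ∀ k → t (x ^ k) ≈ y ^ k
    t-^ tx≈y zero    = t-1
    t-^ {x} {y} tx≈y (suc k) = begin
      t (x * x ^ k)    ≈⟨ t-* x (x ^ k) ⟩
      t (x ^ k) * t x  ≈⟨ *-cong (t-^ tx≈y k) tx≈y ⟩
      y ^ k * y        ≈⟨ ^-comm y k ⟩
      y * y ^ k        ∎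

    U^odd*r : ∀ m → U ^ (m ℕ.+ suc m) * r ≈ U ^ m * (s * U⁻¹ ^ m)
    U^odd*r m = begin
      U ^ (m ℕ.+ suc m) * r              ≈⟨ *-congʳ (^-homo-* U m (suc m)) ⟩
      U ^ m * (s * r * U ^ m) * r        ≈⟨ solve *-monoid ⟩
      U ^ m * (s * (r * U ^ m * r))      ≈⟨ *-congˡ (*-congˡ (^-conj r*r≈1 r*U*r≈U⁻¹ m)) ⟩
      U ^ m * (s * U⁻¹ ^ m)              ∎

    module Period (τ : ℕ) (U^τ*q≈q : U ^ τ * q ≈ q) where

      W E : Carrier
      W = U ^ τ
      E = 1# - W

      U⁻¹^τ*q≈q : U⁻¹ ^ τ * q ≈ q
      U⁻¹^τ*q≈q = begin
        U⁻¹ ^ τ * q        ≈⟨ *-congʳ (^-conj r*r≈1 r*U*r≈U⁻¹ τ) ⟨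
        r * W * r * q      ≈⟨ solve *-monoid ⟩
        r * (W * (r * q))  ≈⟨ *-congˡ (*-congˡ (reflection-fixes q-idem)) ⟩
        r * (W * q)        ≈⟨ *-congˡ U^τ*q≈q ⟩
        r * q              ≈⟨ reflection-fixes q-idem ⟩
        q                  ∎

      q*W≈q : q * W ≈ q
      q*W≈q = begin
        q * W                ≈⟨ *-cong t-q (t-^ t-U⁻¹ τ) ⟨
        t q * t (U⁻¹ ^ τ)    ≈⟨ t-* (U⁻¹ ^ τ) q ⟨
        t (U⁻¹ ^ τ * q)      ≈⟨ t-cong U⁻¹^τ*q≈q ⟩
        t q                  ≈⟨ t-q ⟩
        q                    ∎

      W≈U⁻¹^τ : W ≈ U⁻¹ ^ τ
      W≈U⁻¹^τ = begin
        W              ≈⟨ *-identityˡ W ⟨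
        1# * W         ≈⟨ *-congʳ r*r≈1 ⟨
        r * r * W      ≈⟨ *-assoc r r W ⟩
        r * (r * W)    ≈⟨ *-congˡ (reflection-comm U^τ*q≈q q*W≈q) ⟨
        r * (W * r)    ≈⟨ *-assoc r W r ⟨
        r * W * r      ≈⟨ ^-conj r*r≈1 r*U*r≈U⁻¹ τ ⟩
        U⁻¹ ^ τ        ∎

      W*W≈1 : W * W ≈ 1#
      W*W≈1 = trans (*-congˡ W≈U⁻¹^τ) (^-inverse U*U⁻¹≈1 τ)

      t-W : t W ≈ W
      t-W = trans (t-^ t-U τ) (sym W≈U⁻¹^τ)

      s*W≈W*s : s * W ≈ W * s
      s*W≈W*s = begin
        s * W              ≈⟨ *-identityʳ (s * W) ⟨
        s * W * 1#         ≈⟨ *-congˡ s*s≈1 ⟨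
        s * W * (s * s)    ≈⟨ solve *-monoid ⟩
        s * W * s * s      ≈⟨ *-congʳ (^-conj s*s≈1 s*U*s≈U⁻¹ τ) ⟩
        U⁻¹ ^ τ * s        ≈⟨ *-congʳ W≈U⁻¹^τ ⟨
        W * s              ∎

      E*q≈0 : E * q ≈ 0#
      E*q≈0 = begin
        (1# - W) * q     ≈⟨ [y-z]x≈yx-zx q 1# W ⟩
        1# * q - W * q   ≈⟨ +-cong (*-identityˡ q) (-‿cong U^τ*q≈q) ⟩
        q - q            ≈⟨ -‿inverseʳ q ⟩
        0#               ∎

      E*r≈-E : E * r ≈ - E
      E*r≈-E = *-reflection-negates E*q≈0

      E*W≈-E : E * W ≈ - E
      E*W≈-E = begin
        (1# - W) * W       ≈⟨ [y-z]x≈yx-zx W 1# W ⟩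
        1# * W - W * W     ≈⟨ +-cong (*-identityˡ W) (-‿cong W*W≈1) ⟩
        W - 1#             ≈⟨ ⁻¹-anti-homo‿- 1# W ⟨
        - (1# - W)         ∎

      E*E≈E+E : E * E ≈ E + E
      E*E≈E+E = begin
        E * (1# - W)       ≈⟨ x[y-z]≈xy-xz E 1# W ⟩
        E * 1# - E * W     ≈⟨ +-cong (*-identityʳ E) (-‿cong E*W≈-E) ⟩
        E - - E            ≈⟨ +-congˡ (-‿involutive E) ⟩
        E + E              ∎

      t-E : t E ≈ E
      t-E = begin
        t (1# - W)         ≈⟨ t-+ 1# (- W) ⟩
        t 1# + t (- W)     ≈⟨ +-cong t-1 (t-‿ W) ⟩
        1# - t W           ≈⟨ +-congˡ (-‿cong t-W) ⟩
        1# - W             ∎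

      s*E≈E*s : s * E ≈ E * s
      s*E≈E*s = begin
        s * (1# - W)       ≈⟨ x[y-z]≈xy-xz s 1# W ⟩
        s * 1# - s * W     ≈⟨ +-cong (trans (*-identityʳ s) (sym (*-identityˡ s))) (-‿cong s*W≈W*s) ⟩
        1# * s - W * s     ≈⟨ [y-z]x≈yx-zx s 1# W ⟨
        (1# - W) * s       ∎

      E*U²≈E : E * U ^ 2 ≈ E
      E*U²≈E = begin
        E * (s * r * (s * r * 1#)) ≈⟨ solve *-monoid ⟩
        E * s * r * s * r        ≈⟨ *-congʳ (*-congʳ (*-congʳ s*E≈E*s)) ⟨
        s * E * r * s * r        ≈⟨ *-congʳ (*-congʳ (trans (*-assoc s E r) (*-congˡ E*r≈-E))) ⟩
        s * - E * s * r          ≈⟨ *-congʳ (*-congʳ (-‿distribʳ-* s E)) ⟨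
        - (s * E) * s * r        ≈⟨ *-congʳ (*-congʳ (-‿cong s*E≈E*s)) ⟩
        - (E * s) * s * r        ≈⟨ *-congʳ (-‿distribˡ-* (E * s) s) ⟨
        - (E * s * s) * r        ≈⟨ -‿distribˡ-* (E * s * s) r ⟨
        - (E * s * s * r)        ≈⟨ -‿cong (*-congʳ (*-assoc E s s)) ⟩
        - (E * (s * s) * r)      ≈⟨ -‿cong (*-congʳ (trans (*-congˡ s*s≈1) (*-identityʳ E))) ⟩
        - (E * r)                ≈⟨ -‿cong E*r≈-E ⟩
        - - E                    ≈⟨ -‿involutive E ⟩
        E                        ∎

      W*r≈r+E : W * r ≈ r + E
      W*r≈r+E = begin
        W * r                   ≈⟨ *-congʳ (x-[x-y]≈y 1# W) ⟨
        (1# - E) * r            ≈⟨ [y-z]x≈yx-zx r 1# E ⟩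
        1# * r - E * r          ≈⟨ +-cong (*-identityˡ r) (-‿cong E*r≈-E) ⟩
        r - - E                 ≈⟨ +-congˡ (-‿involutive E) ⟩
        r + E                   ∎

      E≈0⇒W≈1 : E ≈ 0# → W ≈ 1#
      E≈0⇒W≈1 E≈0 = sym (x∙y⁻¹≈ε⇒x≈y 1# W E≈0)

      U^[2τ]≈1 : U ^ (2 ℕ.* τ) ≈ 1#
      U^[2τ]≈1 = begin
        U ^ (τ ℕ.+ (τ ℕ.+ 0))   ≈⟨ ^-homo-* U τ (τ ℕ.+ 0) ⟩
        W * U ^ (τ ℕ.+ 0)       ≈⟨ *-congˡ (^-congʳ U (ℕ.+-identityʳ τ)) ⟩
        W * W                   ≈⟨ W*W≈1 ⟩
        1#                      ∎

      even⇒W≈1 : (∀ x → x ≈ - x → x ≈ 0#) → ∀ m → τ ≡ 2 ℕ.* m → W ≈ 1#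
      even⇒W≈1 x≈-x⇒x≈0 m τ≡2m = E≈0⇒W≈1 (x≈-x⇒x≈0 E (trans (sym E*W≈E) E*W≈-E))
        where
        E*W≈E : E * W ≈ E
        E*W≈E = begin
          E * U ^ τ             ≈⟨ *-congˡ (^-congʳ U τ≡2m) ⟩
          E * U ^ (2 ℕ.* m)     ≈⟨ *-congˡ (^-assocʳ U 2 m) ⟨
          E * (U ^ 2) ^ m       ≈⟨ *-^-fixed E*U²≈E m ⟩
          E                     ∎

module Matrices where
  open import Data.Product.Base using (_,_)
  open import Relation.Binary.PropositionalEquality
    using (_≡_; refl; sym; trans; cong; cong₂; module ≡-Reasoning)
  open import Data.Rational.Base using (ℚ; 0ℚ; _+_; _*_; -_; _-_)
  open import Data.Rational.Properties
  open import Relation.Binary.Bundles using (Setoid)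
  open import Relation.Binary.PropositionalEquality using (isEquivalence)
  import Algebra.Construct.Pointwise as Pointwise
  open import Algebra.Properties.Ring +-*-ring using (+-inverseʳ-unique)
  open Rationals
  open FiniteSums
  open Kronecker
  open ≡-Reasoning

  _+ᴹ_ : ∀ {m n} → Mat m n → Mat m n → Mat m n
  (A +ᴹ B) i j = A i j + B i j

  -ᴹ_ : ∀ {m n} → Mat m n → Mat m n
  (-ᴹ A) i j = - A i j

  0ᴹ : ∀ {m n} → Mat m n
  0ᴹ i j = 0ℚ

  infixl 6 _+ᴹ_
  infix  8 -ᴹ_

  ≈ᴹ-setoid : ℕ → ℕ → Setoid _ _
  ≈ᴹ-setoid m n = record
    { Carrier       = Mat m n
    ; _≈_           = _≈ᴹ_
    ; isEquivalence = Pointwise.isEquivalence (Fin m) (Pointwise.isEquivalence (Fin n) isEquivalence) }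

  ≈ᴹ-trans : ∀ {m n} {A B C : Mat m n} → A ≈ᴹ B → B ≈ᴹ C → A ≈ᴹ C
  ≈ᴹ-trans = Setoid.trans (≈ᴹ-setoid _ _)

  ⊗-cong : ∀ {m n k} {A A′ : Mat m n} {B B′ : Mat n k} → A ≈ᴹ A′ → B ≈ᴹ B′ → (A ⊗ B) ≈ᴹ (A′ ⊗ B′)
  ⊗-cong {n = n} A≈A′ B≈B′ i j = sumFin-cong n (λ l → cong₂ _*_ (A≈A′ i l) (B≈B′ l j))

  ⊗-congˡ : ∀ {m n k} (A : Mat m n) {B B′ : Mat n k} → B ≈ᴹ B′ → (A ⊗ B) ≈ᴹ (A ⊗ B′)
  ⊗-congˡ A = ⊗-cong {A = A} (λ _ _ → refl)

  ⊗-congʳ : ∀ {m n k} {A A′ : Mat m n} (B : Mat n k) → A ≈ᴹ A′ → (A ⊗ B) ≈ᴹ (A′ ⊗ B)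
  ⊗-congʳ B A≈A′ = ⊗-cong {B = B} A≈A′ (λ _ _ → refl)

  ⊗-assoc : ∀ {m n k p} (A : Mat m n) (B : Mat n k) (C : Mat k p) → ((A ⊗ B) ⊗ C) ≈ᴹ (A ⊗ (B ⊗ C))
  ⊗-assoc {n = n} {k} A B C i j = begin
    sumFin k (λ l → sumFin n (λ r → A i r * B r l) * C l j)
      ≡⟨ sumFin-cong k (λ l → trans (*-comm _ (C l j)) (sym (sumFin-*ˡ n (C l j) _))) ⟩
    sumFin k (λ l → sumFin n (λ r → C l j * (A i r * B r l)))
      ≡⟨ sumFin-comm k n _ ⟩
    sumFin n (λ r → sumFin k (λ l → C l j * (A i r * B r l)))
      ≡⟨ sumFin-cong n (λ r → sumFin-cong k (λ l → rearrange (C l j) (A i r) (B r l))) ⟩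
    sumFin n (λ r → sumFin k (λ l → A i r * (B r l * C l j)))
      ≡⟨ sumFin-cong n (λ r → sumFin-*ˡ k (A i r) _) ⟩
    sumFin n (λ r → A i r * sumFin k (λ l → B r l * C l j)) ∎
    where
    rearrange : ∀ c a b → c * (a * b) ≡ a * (b * c)
    rearrange c a b = trans (*-comm c (a * b)) (*-assoc a b c)

  ⊗-identityˡ : ∀ {m n} (A : Mat m n) → (idMat m ⊗ A) ≈ᴹ A
  ⊗-identityˡ {m} A i j = sumFin-δˡ m i (λ l → A l j)

  ⊗-identityʳ : ∀ {m n} (A : Mat m n) → (A ⊗ idMat n) ≈ᴹ A
  ⊗-identityʳ {n = n} A i j = sumFin-δʳ n j (A i)

  ⊗-distribˡ : ∀ {m n k} (A : Mat m n) (B C : Mat n k) → (A ⊗ (B +ᴹ C)) ≈ᴹ (A ⊗ B +ᴹ A ⊗ C)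
  ⊗-distribˡ {n = n} A B C i j =
    trans (sumFin-cong n (λ l → *-distribˡ-+ (A i l) (B l j) (C l j))) (sumFin-+ n _ _)

  ⊗-distribʳ : ∀ {m n k} (C : Mat n k) (A B : Mat m n) → ((A +ᴹ B) ⊗ C) ≈ᴹ (A ⊗ C +ᴹ B ⊗ C)
  ⊗-distribʳ {n = n} C A B i j =
    trans (sumFin-cong n (λ l → *-distribʳ-+ (C l j) (A i l) (B i l))) (sumFin-+ n _ _)

  Mat-ring : ℕ → Ring _ _
  Mat-ring n = record
    { Carrier = Mat n n
    ; _≈_     = _≈ᴹ_
    ; _+_     = _+ᴹ_
    ; _*_     = _⊗_
    ; -_      = -ᴹ_
    ; 0#      = 0ᴹ
    ; 1#      = idMat n
    ; isRing  = record
      { +-isAbelianGroup =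
          Pointwise.isAbelianGroup (Fin n) (Pointwise.isAbelianGroup (Fin n) +-0-isAbelianGroup)
      ; *-cong     = ⊗-cong
      ; *-assoc    = ⊗-assoc
      ; *-identity = ⊗-identityˡ , ⊗-identityʳ
      ; distrib    = ⊗-distribˡ , ⊗-distribʳ
      }
    }

  transpose-⊗ : ∀ {m n k} (A : Mat m n) (B : Mat n k) → transpose (A ⊗ B) ≈ᴹ (transpose B ⊗ transpose A)
  transpose-⊗ {n = n} A B i j = sumFin-cong n (λ l → *-comm (A j l) (B l i))

  transpose-idMat : ∀ n → transpose (idMat n) ≈ᴹ idMat n
  transpose-idMat n i j = δ-sym j i

  tr : ∀ {n} → Mat n n → ℚ
  tr {n} A = sumFin n (λ i → A i i)

  tr-cong : ∀ {n} {A B : Mat n n} → A ≈ᴹ B → tr A ≡ tr B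
  tr-cong {n} A≈B = sumFin-cong n (λ i → A≈B i i)

  tr-+ : ∀ {n} (A B : Mat n n) → tr (A +ᴹ B) ≡ tr A + tr B
  tr-+ {n} A B = sumFin-+ n _ _

  tr-⊗-comm : ∀ {m n} (A : Mat m n) (B : Mat n m) → tr (A ⊗ B) ≡ tr (B ⊗ A)
  tr-⊗-comm {m} {n} A B = trans (sumFin-comm m n (λ i l → A i l * B l i))
    (sumFin-cong n (λ l → sumFin-cong m (λ i → *-comm (A i l) (B l i))))

  tr-‿ : ∀ {n} (A : Mat n n) → tr (-ᴹ A) ≡ - tr A
  tr-‿ {n} A = +-inverseʳ-unique (tr A) (tr (-ᴹ A))
    (trans (sym (tr-+ A (-ᴹ A))) (trans (tr-cong (λ i j → +-inverseʳ (A i j))) (sumFin-0 n)))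

  tr-idMat : ∀ n → tr (idMat n) ≡ fromℕ n
  tr-idMat n = trans (sumFin-cong n δ-diag) (sumFin-const-1 n)

  tr-reflection : ∀ {n} (A : Mat n n) → tr (Reflections.reflection (Mat-ring n) A) ≡ (tr A + tr A) - fromℕ n
  tr-reflection {n} A = begin
    tr ((A +ᴹ A) +ᴹ -ᴹ idMat n)         ≡⟨ tr-+ (A +ᴹ A) (-ᴹ idMat n) ⟩
    tr (A +ᴹ A) + tr (-ᴹ idMat n)       ≡⟨ cong₂ _+_ (tr-+ A A) (tr-‿ (idMat n)) ⟩
    (tr A + tr A) - tr (idMat n)        ≡⟨ cong (λ x → (tr A + tr A) - x) (tr-idMat n) ⟩
    (tr A + tr A) - fromℕ n             ∎

  tr-⊗-transpose≡0⇒≈0 : ∀ {m n} (A : Mat m n) → tr (A ⊗ transpose A) ≡ 0ℚ → A ≈ᴹ 0ᴹ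
  tr-⊗-transpose≡0⇒≈0 {m} {n} A tr≡0 i j =
    x*x≡0⇒x≡0 (A i j) (sumFin≡0⇒≡0 n (λ l → A i l * A i l) (λ l → x*x-nonneg (A i l)) row≡0 j)
    where
    row≡0 : sumFin n (λ l → A i l * A i l) ≡ 0ℚ
    row≡0 = sumFin≡0⇒≡0 m _ (λ i → sumFin-nonneg n _ (λ l → x*x-nonneg (A i l))) tr≡0 i

  symmetric∧E⊗E≈E+E∧tr≡0⇒≈0 : ∀ {n} (E : Mat n n) →
    transpose E ≈ᴹ E → (E ⊗ E) ≈ᴹ (E +ᴹ E) → tr E ≡ 0ℚ → E ≈ᴹ 0ᴹ
  symmetric∧E⊗E≈E+E∧tr≡0⇒≈0 E Eᵀ≈E E⊗E≈E+E trE≡0 = tr-⊗-transpose≡0⇒≈0 E (begin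
    tr (E ⊗ transpose E)  ≡⟨ tr-cong (⊗-congˡ E Eᵀ≈E) ⟩
    tr (E ⊗ E)            ≡⟨ tr-cong E⊗E≈E+E ⟩
    tr (E +ᴹ E)           ≡⟨ tr-+ E E ⟩
    tr E + tr E           ≡⟨ cong₂ _+_ trE≡0 trE≡0 ⟩
    0ℚ + 0ℚ               ≡⟨ +-identityʳ 0ℚ ⟩
    0ℚ                    ∎)

  A≈-A⇒A≈0 : ∀ {m n} (A : Mat m n) → A ≈ᴹ (-ᴹ A) → A ≈ᴹ 0ᴹ
  A≈-A⇒A≈0 A A≈-A i j = x≡-x⇒x≡0 (A i j) (A≈-A i j)

  transpose-cong : ∀ {m n} {A B : Mat m n} → A ≈ᴹ B → transpose A ≈ᴹ transpose B
  transpose-cong A≈B i j = A≈B j i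

  transpose-+ : ∀ {m n} (A B : Mat m n) → transpose (A +ᴹ B) ≈ᴹ (transpose A +ᴹ transpose B)
  transpose-+ A B i j = refl

  transpose-‿ : ∀ {m n} (A : Mat m n) → transpose (-ᴹ A) ≈ᴹ (-ᴹ transpose A)
  transpose-‿ A i j = refl

-- N, D, D⁻¹ and Q are Nmat, Dmat, Dinv and Qmat taken for an arbitrary surjection π,
-- so that vertices (π = vert) and faces (π = face, giving Pmat) are treated alike.
module Incidence {nA n : ℕ} (π : Fin nA → Fin n) (π-surjective : ∀ v → ∃ λ a → π a ≡ v) where
  open import Data.Product.Base using (_,_)
  open import Relation.Binary.PropositionalEquality
    using (_≢_; refl; sym; trans; cong; module ≡-Reasoning)
  open import Algebra.Bundles using (CommutativeRing)
  open import Data.Rational.Base using (ℚ; 0ℚ; 1ℚ; _*_)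
  open import Data.Rational.Properties
  open import Algebra.Properties.CommutativeSemigroup (CommutativeRing.*-commutativeSemigroup +-*-commutativeRing)
    using (x∙yz≈y∙xz)
  import Relation.Binary.Reasoning.Setoid as SetoidReasoning
  open Rationals
  open FiniteSums
  open Kronecker
  open Matrices

  N : Mat nA n
  N a v = δ (π a) v

  D : Mat n n
  D = transpose N ⊗ N

  D⁻¹ : Mat n n
  D⁻¹ v w = δ v w * inv0 (D v v)

  Q : Mat nA nA
  Q = (N ⊗ D⁻¹) ⊗ transpose N

  degree : Fin n → ℚ
  degree v = sumFin nA (λ a → δ (π a) v)

  D-entry : ∀ v w → D v w ≡ degree v * δ v w
  D-entry v w = begin
    sumFin nA (λ a → δ (π a) v * δ (π a) w) ≡⟨ sumFin-cong nA (λ a → δ-*-transport (π a) v (λ x → δ x w)) ⟩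
    sumFin nA (λ a → δ (π a) v * δ v w)     ≡⟨ sumFin-cong nA (λ a → *-comm (δ (π a) v) (δ v w)) ⟩
    sumFin nA (λ a → δ v w * δ (π a) v)     ≡⟨ sumFin-*ˡ nA (δ v w) _ ⟩
    δ v w * degree v                        ≡⟨ *-comm (δ v w) (degree v) ⟩
    degree v * δ v w                        ∎
    where open ≡-Reasoning

  D-diagonal : ∀ v → D v v ≡ degree v
  D-diagonal v = trans (D-entry v v) (trans (cong (degree v *_) (δ-diag v)) (*-identityʳ (degree v)))

  degree≢0 : ∀ v → degree v ≢ 0ℚ
  degree≢0 v degree≡0 with π-surjective v
  ... | a , refl = 1≢0 (trans (sym (δ-diag (π a)))
    (sumFin≡0⇒≡0 nA (λ b → δ (π b) (π a)) (λ b → δ-nonneg (π b) (π a)) degree≡0 a))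

  D⊗D⁻¹ : (D ⊗ D⁻¹) ≈ᴹ idMat n
  D⊗D⁻¹ v w = begin
    sumFin n (λ l → D v l * D⁻¹ l w)              ≡⟨ sumFin-cong n (λ l → cong (_* D⁻¹ l w) (D-entry v l)) ⟩
    sumFin n (λ l → (degree v * δ v l) * D⁻¹ l w) ≡⟨ sumFin-cong n (λ l → *-assoc (degree v) (δ v l) (D⁻¹ l w)) ⟩
    sumFin n (λ l → degree v * (δ v l * D⁻¹ l w)) ≡⟨ sumFin-*ˡ n (degree v) _ ⟩
    degree v * sumFin n (λ l → δ v l * D⁻¹ l w)   ≡⟨ cong (degree v *_) (sumFin-δˡ n v (λ l → D⁻¹ l w)) ⟩
    degree v * (δ v w * inv0 (D v v))             ≡⟨ x∙yz≈y∙xz (degree v) (δ v w) (inv0 (D v v)) ⟩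
    δ v w * (degree v * inv0 (D v v))             ≡⟨ cong (λ d → δ v w * (d * inv0 (D v v))) (D-diagonal v) ⟨
    δ v w * (D v v * inv0 (D v v))                ≡⟨ cong (δ v w *_) (inv0-inverseʳ (D v v) D≢0) ⟩
    δ v w * 1ℚ                                    ≡⟨ *-identityʳ (δ v w) ⟩
    δ v w                                         ∎
    where
    open ≡-Reasoning
    D≢0 : D v v ≢ 0ℚ
    D≢0 D≡0 = degree≢0 v (trans (sym (D-diagonal v)) D≡0)

  D⁻¹-symmetric : transpose D⁻¹ ≈ᴹ D⁻¹
  D⁻¹-symmetric v w = begin
    δ w v * inv0 (D w w) ≡⟨ δ-*-transport w v (λ x → inv0 (D x x)) ⟩
    δ w v * inv0 (D v v) ≡⟨ cong (_* inv0 (D v v)) (δ-sym w v) ⟩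
    δ v w * inv0 (D v v) ∎
    where open ≡-Reasoning

  Nᵀ⊗N⊗D⁻¹ : (transpose N ⊗ (N ⊗ D⁻¹)) ≈ᴹ idMat n
  Nᵀ⊗N⊗D⁻¹ v w = trans (sym (⊗-assoc (transpose N) N D⁻¹ v w)) (D⊗D⁻¹ v w)

  Q-idempotent : (Q ⊗ Q) ≈ᴹ Q
  Q-idempotent = begin
    (K ⊗ Nᵀ) ⊗ (K ⊗ Nᵀ)  ≈⟨ ⊗-assoc K Nᵀ (K ⊗ Nᵀ) ⟩
    K ⊗ (Nᵀ ⊗ (K ⊗ Nᵀ))  ≈⟨ ⊗-congˡ K (⊗-assoc Nᵀ K Nᵀ) ⟨
    K ⊗ ((Nᵀ ⊗ K) ⊗ Nᵀ)  ≈⟨ ⊗-congˡ K (⊗-congʳ Nᵀ Nᵀ⊗N⊗D⁻¹) ⟩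
    K ⊗ (idMat n ⊗ Nᵀ)   ≈⟨ ⊗-congˡ K (⊗-identityˡ Nᵀ) ⟩
    K ⊗ Nᵀ               ∎
    where
    open SetoidReasoning (≈ᴹ-setoid nA nA)
    K = N ⊗ D⁻¹
    Nᵀ = transpose N

  Q-symmetric : transpose Q ≈ᴹ Q
  Q-symmetric = begin
    transpose ((N ⊗ D⁻¹) ⊗ transpose N) ≈⟨ transpose-⊗ (N ⊗ D⁻¹) (transpose N) ⟩
    N ⊗ transpose (N ⊗ D⁻¹)             ≈⟨ ⊗-congˡ N (transpose-⊗ N D⁻¹) ⟩
    N ⊗ (transpose D⁻¹ ⊗ transpose N)   ≈⟨ ⊗-congˡ N (⊗-congʳ (transpose N) D⁻¹-symmetric) ⟩
    N ⊗ (D⁻¹ ⊗ transpose N)             ≈⟨ ⊗-assoc N D⁻¹ (transpose N) ⟨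
    (N ⊗ D⁻¹) ⊗ transpose N             ∎
    where open SetoidReasoning (≈ᴹ-setoid nA nA)

  tr-Q : tr Q ≡ fromℕ n
  tr-Q = trans (tr-⊗-comm (N ⊗ D⁻¹) (transpose N)) (trans (tr-cong Nᵀ⊗N⊗D⁻¹) (tr-idMat n))

  ⊗-N-fixed⇒⊗-Q-fixed : ∀ (W : Mat nA nA) → (W ⊗ N) ≈ᴹ N → (W ⊗ Q) ≈ᴹ Q
  ⊗-N-fixed⇒⊗-Q-fixed W WN≈N = begin
    W ⊗ ((N ⊗ D⁻¹) ⊗ transpose N)  ≈⟨ ⊗-assoc W (N ⊗ D⁻¹) (transpose N) ⟨
    (W ⊗ (N ⊗ D⁻¹)) ⊗ transpose N  ≈⟨ ⊗-congʳ (transpose N) (⊗-assoc W N D⁻¹) ⟨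
    ((W ⊗ N) ⊗ D⁻¹) ⊗ transpose N  ≈⟨ ⊗-congʳ (transpose N) (⊗-congʳ D⁻¹ WN≈N) ⟩
    (N ⊗ D⁻¹) ⊗ transpose N        ∎
    where open SetoidReasoning (≈ᴹ-setoid nA nA)


open import Data.Nat using (_≤_; _%_; _*_; _/_)
open import Data.Product using (_×_; _,_)
open import Function.Bundles using (_⇔_; mk⇔)

module Parity where
  open import Data.Nat using (suc; _+_)
  open import Data.Nat.DivMod using (m≡m%n+[m/n]*n)
  open import Data.Nat.Tactic.RingSolver using (solve-∀)
  open import Relation.Binary.PropositionalEquality using (trans; cong)

  m*2≡2*m : ∀ m → m * 2 ≡ 2 * m
  m*2≡2*m = solve-∀

  1+m*2≡m+suc-m : ∀ m → 1 + m * 2 ≡ m + suc m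
  1+m*2≡m+suc-m = solve-∀

  %2≡0⇒even : ∀ τ → τ % 2 ≡ 0 → τ ≡ 2 * (τ / 2)
  %2≡0⇒even τ τ%2≡0 =
    trans (m≡m%n+[m/n]*n τ 2) (trans (cong (_+ (τ / 2) * 2) τ%2≡0) (m*2≡2*m (τ / 2)))

  %2≡1⇒odd : ∀ τ → τ % 2 ≡ 1 → τ ≡ τ / 2 + suc (τ / 2)
  %2≡1⇒odd τ τ%2≡1 =
    trans (m≡m%n+[m/n]*n τ 2) (trans (cong (_+ (τ / 2) * 2) τ%2≡1) (1+m*2≡m+suc-m (τ / 2)))

module MapWalk (X : OrientableMap) where
  open OrientableMap X
  open import Data.Nat as ℕ using (suc)
  open import Data.Rational.Base using (_+_; _-_; -_)
  open import Data.Rational.Properties using (+-*-ring)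
  open import Algebra.Properties.Ring +-*-ring using (+-cancelʳ; +-identityʳ-unique)
  open import Relation.Binary.PropositionalEquality using (refl; sym; trans; cong; subst; module ≡-Reasoning)
  open Rationals
  open Matrices
  open Parity
  open import Algebra.Properties.Semiring.Exp (Ring.semiring (Mat-ring nA)) using (_^_)
  module V = Incidence vert vert-surj
  module F = Incidence face face-surj
  open Reflections (Mat-ring nA)
  open Walk transpose transpose-cong transpose-+ transpose-‿ transpose-⊗ (transpose-idMat nA)
    V.Q-idempotent F.Q-idempotent V.Q-symmetric F.Q-symmetric

  matPow≡U^ : ∀ k → matPow (Umat X) k ≡ U ^ k
  matPow≡U^ zero    = refl
  matPow≡U^ (suc k) = cong (U ⊗_) (matPow≡U^ k)

  U^≈1⇒matPow≈I : ∀ k → (U ^ k) ≈ᴹ idMat nA → matPow (Umat X) k ≈ᴹ idMat nA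
  U^≈1⇒matPow≈I k = subst (_≈ᴹ idMat nA) (sym (matPow≡U^ k))

  matPow≈I⇒U^≈1 : ∀ k → matPow (Umat X) k ≈ᴹ idMat nA → (U ^ k) ≈ᴹ idMat nA
  matPow≈I⇒U^≈1 k = subst (_≈ᴹ idMat nA) (matPow≡U^ k)

  periodic⇒U^τ*Q≈Q : ∀ τ → Periodic X τ → ((U ^ τ) ⊗ Qmat X) ≈ᴹ Qmat X
  periodic⇒U^τ*Q≈Q τ per =
    V.⊗-N-fixed⇒⊗-Q-fixed (U ^ τ) (subst (λ M → (M ⊗ Nmat X) ≈ᴹ Nmat X) (matPow≡U^ τ) per)

  matPow≈I⇒periodic : ∀ τ → matPow (Umat X) τ ≈ᴹ idMat nA → Periodic X τ
  matPow≈I⇒periodic τ U^τ≈I = ≈ᴹ-trans (⊗-congʳ (Nmat X) U^τ≈I) (⊗-identityˡ (Nmat X))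

  tr-r : tr r ≡ (fromℕ nV + fromℕ nV) - fromℕ nA
  tr-r = trans (tr-reflection (Qmat X)) (cong (λ x → (x + x) - fromℕ nA) V.tr-Q)

  tr-s : tr s ≡ (fromℕ nF + fromℕ nF) - fromℕ nA
  tr-s = trans (tr-reflection (Pmat X)) (cong (λ x → (x + x) - fromℕ nA) F.tr-Q)

  tr-r≡tr-s⇒nV≡nF : tr r ≡ tr s → nV ≡ nF
  tr-r≡tr-s⇒nV≡nF tr-r≡tr-s = fromℕ-injective nV nF
    (x+x≡y+y⇒x≡y (fromℕ nV) (fromℕ nF) (+-cancelʳ (- fromℕ nA) _ _ (trans (sym tr-r) (trans tr-r≡tr-s tr-s))))

  nV≡nF⇒tr-r≡tr-s : nV ≡ nF → tr r ≡ tr s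
  nV≡nF⇒tr-r≡tr-s nV≡nF = trans tr-r (trans (cong (λ k → (fromℕ k + fromℕ k) - fromℕ nA) nV≡nF) (sym tr-s))

  tr-U^odd*r≡tr-s : ∀ m τ → τ ≡ m ℕ.+ suc m → tr ((U ^ τ) ⊗ r) ≡ tr s
  tr-U^odd*r≡tr-s m τ τ≡m+1+m = begin
    tr ((U ^ τ) ⊗ r)                    ≡⟨ cong (λ k → tr ((U ^ k) ⊗ r)) τ≡m+1+m ⟩
    tr ((U ^ (m ℕ.+ suc m)) ⊗ r)        ≡⟨ tr-cong (U^odd*r m) ⟩
    tr ((U ^ m) ⊗ (s ⊗ (U⁻¹ ^ m)))      ≡⟨ tr-⊗-comm (U ^ m) (s ⊗ (U⁻¹ ^ m)) ⟩
    tr ((s ⊗ (U⁻¹ ^ m)) ⊗ (U ^ m))      ≡⟨ tr-cong (⊗-assoc s (U⁻¹ ^ m) (U ^ m)) ⟩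
    tr (s ⊗ ((U⁻¹ ^ m) ⊗ (U ^ m)))      ≡⟨ tr-cong (⊗-congˡ s (^-inverse U⁻¹*U≈1 m)) ⟩
    tr (s ⊗ idMat nA)                   ≡⟨ tr-cong (⊗-identityʳ s) ⟩
    tr s                                ∎
    where open ≡-Reasoning

  even-periodic⇒matPow≈I : ∀ m τ → τ ≡ 2 * m → Periodic X τ → matPow (Umat X) τ ≈ᴹ idMat nA
  even-periodic⇒matPow≈I m τ τ≡2m per =
    U^≈1⇒matPow≈I τ (Period.even⇒W≈1 τ (periodic⇒U^τ*Q≈Q τ per) A≈-A⇒A≈0 m τ≡2m)

  odd-matPow≈I⇒nV≡nF : ∀ m τ → τ ≡ m ℕ.+ suc m → matPow (Umat X) τ ≈ᴹ idMat nA → nV ≡ nF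
  odd-matPow≈I⇒nV≡nF m τ τ≡m+1+m U^τ≈I = tr-r≡tr-s⇒nV≡nF (begin
    tr r                   ≡⟨ tr-cong (⊗-identityˡ r) ⟨
    tr (idMat nA ⊗ r)      ≡⟨ tr-cong (⊗-congʳ r (matPow≈I⇒U^≈1 τ U^τ≈I)) ⟨
    tr ((U ^ τ) ⊗ r)       ≡⟨ tr-U^odd*r≡tr-s m τ τ≡m+1+m ⟩
    tr s                   ∎)
    where open ≡-Reasoning

  odd-periodic⇒matPow≈I : ∀ m τ → τ ≡ m ℕ.+ suc m → Periodic X τ → nV ≡ nF →
    matPow (Umat X) τ ≈ᴹ idMat nA
  odd-periodic⇒matPow≈I m τ τ≡m+1+m per nV≡nF = U^≈1⇒matPow≈I τ (E≈0⇒W≈1 E≈0)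
    where
    open Period τ (periodic⇒U^τ*Q≈Q τ per)
    open ≡-Reasoning
    tr-r+tr-E≡tr-r : tr r + tr E ≡ tr r
    tr-r+tr-E≡tr-r = begin
      tr r + tr E            ≡⟨ tr-+ r E ⟨
      tr (r +ᴹ E)            ≡⟨ tr-cong W*r≈r+E ⟨
      tr (W ⊗ r)             ≡⟨ tr-U^odd*r≡tr-s m τ τ≡m+1+m ⟩
      tr s                   ≡⟨ nV≡nF⇒tr-r≡tr-s nV≡nF ⟨
      tr r                   ∎
    E≈0 : E ≈ᴹ 0ᴹ
    E≈0 = symmetric∧E⊗E≈E+E∧tr≡0⇒≈0 E t-E E*E≈E+E (+-identityʳ-unique (tr r) (tr E) tr-r+tr-E≡tr-r)

  even⇒matPow≈I⇔periodic : ∀ τ → τ % 2 ≡ 0 → (matPow (Umat X) τ ≈ᴹ idMat nA) ⇔ Periodic X τ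
  even⇒matPow≈I⇔periodic τ τ%2≡0 =
    mk⇔ (matPow≈I⇒periodic τ) (even-periodic⇒matPow≈I (τ / 2) τ (%2≡0⇒even τ τ%2≡0))

  odd⇒matPow≈I⇔periodic×nV≡nF : ∀ τ → τ % 2 ≡ 1 →
    (matPow (Umat X) τ ≈ᴹ idMat nA) ⇔ (Periodic X τ × nV ≡ nF)
  odd⇒matPow≈I⇔periodic×nV≡nF τ τ%2≡1 = mk⇔
    (λ U^τ≈I → matPow≈I⇒periodic τ U^τ≈I , odd-matPow≈I⇒nV≡nF (τ / 2) τ τ-odd U^τ≈I)
    (λ (per , nV≡nF) → odd-periodic⇒matPow≈I (τ / 2) τ τ-odd per nV≡nF)
    where
    τ-odd : τ ≡ τ / 2 ℕ.+ suc (τ / 2)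
    τ-odd = %2≡1⇒odd τ τ%2≡1

  periodic⇒matPow-2τ≈I : ∀ τ → Periodic X τ → matPow (Umat X) (2 * τ) ≈ᴹ idMat nA
  periodic⇒matPow-2τ≈I τ per = U^≈1⇒matPow≈I (2 * τ) (Period.U^[2τ]≈1 τ (periodic⇒U^τ*Q≈Q τ per))


theorem5p2 : (X : OrientableMap) (τ : ℕ) → 1 ≤ τ →
      ((τ % 2 ≡ 0) →
        ((matPow (Umat X) τ ≈ᴹ idMat (OrientableMap.nA X)) ⇔ Periodic X τ))
    × ((τ % 2 ≡ 1) →
        ((matPow (Umat X) τ ≈ᴹ idMat (OrientableMap.nA X))
          ⇔ (Periodic X τ × OrientableMap.nV X ≡ OrientableMap.nF X)))
    × (Periodic X τ → matPow (Umat X) (2 * τ) ≈ᴹ idMat (OrientableMap.nA X))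
theorem5p2 X τ _ =
  even⇒matPow≈I⇔periodic τ , odd⇒matPow≈I⇔periodic×nV≡nF τ , periodic⇒matPow-2τ≈I τ
  where open MapWalk X
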